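{- Let $H$ be a 1-extendable graph, and let $\mathcal{E}(H)=\{G \supseteq H : V(G)=V(H),\ \Phi(G)=\Phi(H)\}$, partially ordered by the subgraph relation. If $G$ is a maximal element of $\mathcal{E}(H)$, then every maximal barrier of $G$ is a clique in $G$ all of whose edges are free in $G$.
   Context: All graphs are finite and simple. $\Phi(G)$ is the number of perfect matchings of $G$. An edge is extendable if it lies in some perfect matching and free otherwise. A connected graph is 1-extendable if every edge is extendable. For $S\subseteq V(G)$, $\operatorname{odd}(G-S)$ is the number of odd-order components of $G-S$; $S$ is a barrier of $G$ if $\operatorname{odd}(G-S)=|S|$ (the empty set counts as a barrier); a maximal barrier is an inclusion-maximal barrier. -}

module Defs where

open import Data.Nat using (ℕ; zero; suc; _≤ᵇ_)
open import Data.Nat.Properties using ()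
open import Data.Bool using (Bool; true; false; _∧_; _∨_; not; if_then_else_)
open import Data.Fin using (Fin; toℕ; _≟_)
open import Data.Vec using (Vec; []; _∷_; lookup)
open import Data.List using (List; length; filterᵇ; allFin; concatMap; map)
open import Data.Bool.ListAction using (all; any)
open import Data.Fin.Subset using (Subset; _∈_; _∉_; _⊆_; ∣_∣)
open import Data.Product using (Σ; _×_; ∃)
open import Relation.Nullary using (¬_; does)
open import Relation.Binary.PropositionalEquality using (_≡_; _≢_)

record Graph (n : ℕ) : Set where
  field
    adj    : Fin n → Fin n → Bool
    sym    : ∀ u v → adj u v ≡ adj v u
    irrefl : ∀ v → adj v v ≡ false
open Graph public

Edge : ∀ {n} → Graph n → Fin n → Fin n → Set
Edge G u v = adj G u v ≡ true

_⊑_ : ∀ {n} → Graph n → Graph n → Set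
H ⊑ G = ∀ u v → Edge H u v → Edge G u v

-- A perfect matching M is encoded by its partner map m : Fin n → Fin n
-- (m v = the vertex matched to v); m is a fixed-point-free involution
-- with v (m v) an edge (fixed-point-freeness follows from irreflexivity).
-- This encoding is a bijection with the set of perfect matchings.

IsPM : ∀ {n} → Graph n → (Fin n → Fin n) → Set
IsPM G m = ∀ v → (m (m v) ≡ v) × Edge G v (m v)

isPMᵇ : ∀ {n} → Graph n → (Fin n → Fin n) → Bool
isPMᵇ {n} G m = all (λ v → does (m (m v) ≟ v) ∧ adj G v (m v)) (allFin n)

allVecs : (n k : ℕ) → List (Vec (Fin k) n)
allVecs zero    k = [] ∷ []  where open Data.List using (_∷_; [])
allVecs (suc n) k = concatMap (λ x → map (x ∷_) (allVecs n k)) (allFin k)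

Φ : ∀ {n} → Graph n → ℕ
Φ {n} G = length (filterᵇ (λ xs → isPMᵇ G (lookup xs)) (allVecs n n))

Extendable : ∀ {n} → Graph n → Fin n → Fin n → Set
Extendable G u v = Σ (Fin _ → Fin _) λ m → IsPM G m × (m u ≡ v)

Free : ∀ {n} → Graph n → Fin n → Fin n → Set
Free G u v = ¬ Extendable G u v

data Reach {n} (G : Graph n) : Fin n → Fin n → Set where
  here : ∀ {v} → Reach G v v
  step : ∀ {u w v} → Edge G u w → Reach G w v → Reach G u v

Connected : ∀ {n} → Graph n → Set
Connected G = ∀ u v → Reach G u v

OneExtendable : ∀ {n} → Graph n → Set
OneExtendable G = Connected G × (∀ u v → Edge G u v → Extendable G u v)

inS : ∀ {n} → Subset n → Fin n → Bool
inS S w = lookup S w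

expand : ∀ {n} → Graph n → Subset n → (Fin n → Bool) → (Fin n → Bool)
expand {n} G S C w = C w ∨ (not (inS S w) ∧ any (λ u → C u ∧ adj G u w) (allFin n))

iter : ∀ {A : Set} → ℕ → (A → A) → A → A
iter zero    f a = a
iter (suc k) f a = f (iter k f a)

-- vertex set of the component of G - S containing v (for v ∉ S):
-- n expansion steps suffice since paths have at most n - 1 edges.
comp : ∀ {n} → Graph n → Subset n → Fin n → (Fin n → Bool)
comp {n} G S v = iter n (expand G S) (λ w → does (w ≟ v))

compSize : ∀ {n} → Graph n → Subset n → Fin n → ℕ
compSize {n} G S v = length (filterᵇ (comp G S v) (allFin n))

isOdd : ℕ → Bool
isOdd zero          = false
isOdd (suc zero)    = true
isOdd (suc (suc k)) = isOdd k

isRep : ∀ {n} → Graph n → Subset n → Fin n → Bool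
isRep {n} G S v = not (inS S v) ∧ all (λ w → if comp G S v w then toℕ v ≤ᵇ toℕ w else true) (allFin n)

oddComps : ∀ {n} → Graph n → Subset n → ℕ
oddComps {n} G S = length (filterᵇ (λ v → isRep G S v ∧ isOdd (compSize G S v)) (allFin n))

Barrier : ∀ {n} → Graph n → Subset n → Set
Barrier G S = oddComps G S ≡ ∣ S ∣

MaximalBarrier : ∀ {n} → Graph n → Subset n → Set
MaximalBarrier G S = Barrier G S × (∀ T → Barrier G T → S ⊆ T → T ⊆ S)

InE : ∀ {n} → Graph n → Graph n → Set
InE H G = H ⊑ G × (Φ G ≡ Φ H)

MaximalInE : ∀ {n} → Graph n → Graph n → Set
MaximalInE H G = InE H G × (∀ G' → InE H G' → G ⊑ G' → G' ⊑ G)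

Clique : ∀ {n} → Graph n → Subset n → Set
Clique G S = ∀ u v → u ∈ S → v ∈ S → u ≢ v → Edge G u v

module Submission where

open import Defs hiding (sym)
open import Data.Nat using (ℕ; zero; suc; _+_; _≤_; _<_; _≤ᵇ_; z≤n; s≤s)
open import Data.Nat.Properties
  using (≤-refl; ≤-trans; ≤-reflexive; ≤-antisym; <-irrefl; m≤n⇒m≤1+n; m+1+n≰m; 1+n≢0; ≤ᵇ⇒≤;
         suc-injective; module ≤-Reasoning)
open import Data.Bool using (Bool; true; false; _∧_; _∨_; not; T; if_then_else_) renaming (_≟_ to _≟ᵇ_)
open import Data.Bool.Properties using (T-≡; ∧-conicalˡ; ∧-conicalʳ; ∧-zeroʳ; ∨-zeroʳ; ∨-identityʳ)
open import Data.Bool.ListAction using (all; any; and; or)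
open import Data.Fin using (Fin; zero; suc; toℕ; _≟_)
open import Data.Fin.Properties using (any?; 0≢1+n; toℕ-injective) renaming (suc-injective to fsuc-injective)
open import Data.Fin.Subset using (Subset; _∈_; ∣_∣)
open import Data.List using (length; filterᵇ; allFin; tabulate)
open import Data.List.Properties using (map-cong; filter-≐)
open import Data.List.Relation.Unary.All.Properties using (all⁺; all⁻)
  renaming (tabulate⁺ to All-tabulate⁺; tabulate⁻ to All-tabulate⁻)
open import Data.List.Relation.Unary.Any.Properties using (any⁺; any⁻)
  renaming (tabulate⁺ to Any-tabulate⁺; tabulate⁻ to Any-tabulate⁻)
open import Data.Vec using (lookup) renaming ([] to []ᵛ; _∷_ to _∷ᵛ_)
open import Data.Vec.Properties using ([]=⇒lookup)
open import Data.Product using (Σ-syntax; _×_; _,_; proj₁; proj₂; ∃)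
open import Data.Sum using (_⊎_; inj₁; inj₂)
open import Data.Empty using (⊥-elim)
open import Function using (_∘_; id; Equivalence)
open import Relation.Nullary using (does; yes; no)
open import Relation.Nullary.Decidable using (dec-true; dec-false; T?)
open import Relation.Binary.PropositionalEquality

-- The
-- whole argument rests on one fact: in a barrier no perfect matching uses
-- an edge inside S.  Indeed, by Tutte's counting argument every odd
-- component of G − S contains a vertex matched into S, distinct components
-- giving distinct vertices of S; as there are |S| odd components, every
-- vertex of S is matched out of S.  Hence the edges of G inside S are free,
-- and adding all missing edges inside S ("saturating" S) changes neither
-- G − S (so S stays a barrier) nor the set of perfect matchings.  The
-- saturated graph therefore lies in 𝓔(H), and maximality of G forces it to
-- equal G, i.e. S is a clique.

∧-true : ∀ {a b} → a ∧ b ≡ true → a ≡ true × b ≡ true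
∧-true {a} {b} h = ∧-conicalˡ a b h , ∧-conicalʳ a b h

not-true : ∀ {b} → not b ≡ true → b ≡ false
not-true {false} _ = refl

bool-ext : ∀ {a b} → (a ≡ true → b ≡ true) → (b ≡ true → a ≡ true) → a ≡ b
bool-ext {false} {false} _ _ = refl
bool-ext {false} {true}  _ g = g refl
bool-ext {true}          f _ = sym (f refl)

≟-sym : ∀ {n} (x y : Fin n) → does (x ≟ y) ≡ does (y ≟ x)
≟-sym x y with x ≟ y | y ≟ x
... | yes _   | yes _   = refl
... | no  _   | no  _   = refl
... | yes x≡y | no  y≢x = ⊥-elim (y≢x (sym x≡y))
... | no  x≢y | yes y≡x = ⊥-elim (x≢y (sym y≡x))

∧-swap : ∀ a b c → a ∧ (b ∧ c) ≡ b ∧ (a ∧ c)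
∧-swap true  true  c = refl
∧-swap true  false c = refl
∧-swap false true  c = refl
∧-swap false false c = refl

all-allFin⁺ : ∀ {n} (p : Fin n → Bool) → all p (allFin n) ≡ true → ∀ i → p i ≡ true
all-allFin⁺ {n} p h i =
  Equivalence.to T-≡ (All-tabulate⁻ (all⁺ p (allFin n) (Equivalence.from T-≡ h)) i)

all-allFin⁻ : ∀ {n} (p : Fin n → Bool) → (∀ i → p i ≡ true) → all p (allFin n) ≡ true
all-allFin⁻ p h = Equivalence.to T-≡ (all⁻ p (All-tabulate⁺ (Equivalence.from T-≡ ∘ h)))

any-allFin⁺ : ∀ {n} (p : Fin n → Bool) → any p (allFin n) ≡ true → ∃ λ i → p i ≡ true
any-allFin⁺ {n} p h with i , pi ← Any-tabulate⁻ (any⁻ p (allFin n) (Equivalence.from T-≡ h))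
  = i , Equivalence.to T-≡ pi

any-allFin⁻ : ∀ {n} (p : Fin n → Bool) i → p i ≡ true → any p (allFin n) ≡ true
any-allFin⁻ p i pi = Equivalence.to T-≡ (any⁺ p (Any-tabulate⁺ i (Equivalence.from T-≡ pi)))

point? : ∀ {n} (P : Fin n → Bool) → (∀ i → P i ≡ false) ⊎ ∃ λ i → P i ≡ true
point? P with any? (λ i → P i ≟ᵇ true)
... | yes found = inj₂ found
... | no  none  = inj₁ λ i → ¬true (λ Pi → none (i , Pi))
  where
  ¬true : ∀ {b} → (b ≢ true) → b ≡ false
  ¬true {false} _ = refl
  ¬true {true}  h = ⊥-elim (h refl)

filterᵇ-cong : ∀ {A : Set} {p q : A → Bool} → (∀ x → p x ≡ q x) → ∀ xs → filterᵇ p xs ≡ filterᵇ q xs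
filterᵇ-cong {p = p} {q} p≗q = filter-≐ (T? ∘ p) (T? ∘ q) ((λ {x} → subst T (p≗q x)) , λ {x} → subst T (sym (p≗q x)))

subset-or-witness : ∀ {n} (P Q : Fin n → Bool) →
  (∀ x → P x ≡ true → Q x ≡ true) ⊎ ∃ λ x → P x ≡ true × Q x ≡ false
subset-or-witness P Q with point? (λ x → P x ∧ not (Q x))
... | inj₂ (x , found) = inj₂ (x , witness (P x) (Q x) found)
  where
  witness : ∀ a b → a ∧ not b ≡ true → a ≡ true × b ≡ false
  witness true false _ = refl , refl
... | inj₁ none = inj₁ λ x → inclusion (P x) (Q x) (none x)
  where
  inclusion : ∀ a b → a ∧ not b ≡ false → a ≡ true → b ≡ true
  inclusion true true _ _ = refl

count : ∀ {n} → (Fin n → Bool) → ℕ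
count {zero}  P = 0
count {suc n} P = if P zero then suc (count (P ∘ suc)) else count (P ∘ suc)

count-filter : ∀ {A : Set} {n} (P : A → Bool) (f : Fin n → A) →
  length (filterᵇ P (tabulate f)) ≡ count (P ∘ f)
count-filter {n = zero}  P f = refl
count-filter {n = suc n} P f with P (f zero)
... | true  = cong suc (count-filter P (f ∘ suc))
... | false = count-filter P (f ∘ suc)

count-allFin : ∀ {n} (P : Fin n → Bool) → length (filterᵇ P (allFin n)) ≡ count P
count-allFin P = count-filter P id

count-cong : ∀ {n} {P Q : Fin n → Bool} → (∀ i → P i ≡ Q i) → count P ≡ count Q
count-cong {zero}  _ = refl
count-cong {suc n} {P} {Q} P≗Q
  rewrite P≗Q zero | count-cong {P = P ∘ suc} {Q ∘ suc} (P≗Q ∘ suc) = refl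

count-≤ : ∀ {n} (P : Fin n → Bool) → count P ≤ n
count-≤ {zero}  P = z≤n
count-≤ {suc n} P with P zero
... | true  = s≤s (count-≤ (P ∘ suc))
... | false = m≤n⇒m≤1+n (count-≤ (P ∘ suc))

remove : ∀ {n} → (Fin n → Bool) → Fin n → Fin n → Bool
remove P y i = if does (i ≟ y) then false else P i

remove-intro : ∀ {n} (P : Fin n → Bool) {y i} → i ≢ y → P i ≡ true → remove P y i ≡ true
remove-intro P {y} {i} i≢y Pi with i ≟ y
... | yes i≡y = ⊥-elim (i≢y i≡y)
... | no  _   = Pi

remove-elim : ∀ {n} (P : Fin n → Bool) {y i} → remove P y i ≡ true → i ≢ y × P i ≡ true
remove-elim P {y} {i} h with i ≟ y
... | no i≢y = i≢y , h

count-remove : ∀ {n} (P : Fin n → Bool) y → P y ≡ true → count P ≡ suc (count (remove P y))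
count-remove {suc n} P zero    Py rewrite Py = refl
count-remove {suc n} P (suc y) Py with P zero
... | true  = cong suc (count-remove (P ∘ suc) y Py)
... | false = count-remove (P ∘ suc) y Py

count-injection : ∀ {n k} (P : Fin n → Bool) (Q : Fin k → Bool)
  (f : ∀ i → P i ≡ true → Fin k) → (∀ i p → Q (f i p) ≡ true) →
  (∀ i j p q → f i p ≡ f j q → i ≡ j) → count P ≤ count Q
count-injection {zero}  P Q f fQ f-inj = z≤n
count-injection {suc n} P Q f fQ f-inj with P zero in P0
... | false = count-injection (P ∘ suc) Q (f ∘ suc) (fQ ∘ suc)
                (λ i j p q e → fsuc-injective (f-inj (suc i) (suc j) p q e))
... | true  = ≤-trans (s≤s rest) (≤-reflexive (sym (count-remove Q y (fQ zero P0))))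
  where
  y = f zero P0
  avoids-y : ∀ i p → remove Q y (f (suc i) p) ≡ true
  avoids-y i p = remove-intro Q (λ e → 0≢1+n (sym (f-inj (suc i) zero p P0 e))) (fQ (suc i) p)
  rest : count (P ∘ suc) ≤ count (remove Q y)
  rest = count-injection (P ∘ suc) (remove Q y) (f ∘ suc) avoids-y
           (λ i j p q e → fsuc-injective (f-inj (suc i) (suc j) p q e))

count-strict : ∀ {n} (P Q : Fin n → Bool) → (∀ i → P i ≡ true → Q i ≡ true) →
  ∀ w → P w ≡ false → Q w ≡ true → suc (count P) ≤ count Q
count-strict P Q P⊆Q w Pw Qw = ≤-trans (s≤s P≤Q-w) (≤-reflexive (sym (count-remove Q w Qw)))
  where
  P≤Q-w : count P ≤ count (remove Q w)
  P≤Q-w = count-injection P (remove Q w) (λ i _ → i)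
    (λ i p → remove-intro Q (λ { refl → true≢false (trans (sym p) Pw) }) (P⊆Q i p))
    (λ i j _ _ e → e)
    where
    true≢false : true ≢ false
    true≢false ()

count-none : ∀ {n} (P : Fin n → Bool) → (∀ i → P i ≡ false) → count P ≡ 0
count-none {zero}  P _ = refl
count-none {suc n} P h rewrite h zero = count-none (P ∘ suc) (h ∘ suc)

card-count : ∀ {n} (S : Subset n) → ∣ S ∣ ≡ count (inS S)
card-count []ᵛ           = refl
card-count (true  ∷ᵛ S) = cong suc (card-count S)
card-count (false ∷ᵛ S) = card-count S

-- A set closed under a fixed-point-free involution m has even size: its
-- points split into pairs {w , m w}.
module _ {n} (m : Fin n → Fin n) (m-inv : ∀ x → m (m x) ≡ x) (m-fpf : ∀ x → m x ≢ x) where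

  Closed : (Fin n → Bool) → Set
  Closed P = ∀ x → P x ≡ true → P (m x) ≡ true

  remove-pair : ∀ P → Closed P → (∀ i → P i ≡ false) ⊎
    Σ[ P′ ∈ (Fin n → Bool) ] Closed P′ × count P ≡ suc (suc (count P′))
  remove-pair P closed with point? P
  ... | inj₁ none = inj₁ none
  ... | inj₂ (w , Pw) = inj₂ (P′ , closed′ , size)
    where
    P₋ = remove P w
    P′ = remove P₋ (m w)
    size : count P ≡ suc (suc (count P′))
    size = trans (count-remove P w Pw)
      (cong suc (count-remove P₋ (m w) (remove-intro P (m-fpf w) (closed w Pw))))
    closed′ : Closed P′
    closed′ x P′x with remove-elim P₋ P′x
    ... | x≢mw , P₋x with remove-elim P P₋x
    ... | x≢w , Px = remove-intro P₋ (λ e → x≢w (trans (sym (m-inv x)) (trans (cong m e) (m-inv w))))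
          (remove-intro P (λ e → x≢mw (trans (sym (m-inv x)) (cong m e))) (closed x Px))

  even-of-size : ∀ k P → Closed P → count P ≡ k → isOdd k ≡ false
  even-of-size zero          P closed size = refl
  even-of-size (suc k)       P closed size with remove-pair P closed
  even-of-size (suc k)       P closed size | inj₁ none =
    ⊥-elim (1+n≢0 (trans (sym size) (count-none P none)))
  even-of-size (suc zero)    P closed size | inj₂ (_ , _ , size′) =
    ⊥-elim (1+n≢0 (suc-injective (trans (sym size′) size)))
  even-of-size (suc (suc k)) P closed size | inj₂ (P′ , closed′ , size′) =
    even-of-size k P′ closed′ (suc-injective (suc-injective (trans (sym size′) size)))

  closed-even : ∀ P → Closed P → isOdd (count P) ≡ false
  closed-even P closed = even-of-size (count P) P closed refl

-- An extensional, inflationary operator f on subsets of Fin n reaches a fixed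
-- point after n iterations from any nonempty start: until it is fixed, every
-- iteration adds a point, and there is only room for n points.
module Stabilise {n} (f : (Fin n → Bool) → (Fin n → Bool))
  (f-cong : ∀ {C D} → (∀ x → C x ≡ D x) → ∀ x → f C x ≡ f D x)
  (f-infl : ∀ C x → C x ≡ true → f C x ≡ true) where

  Fixed : (Fin n → Bool) → Set
  Fixed C = ∀ x → f C x ≡ C x

  fixed-or-grows : ∀ C → Fixed C ⊎ ∃ λ w → f C w ≡ true × C w ≡ false
  fixed-or-grows C with subset-or-witness (f C) C
  ... | inj₁ no-new = inj₁ λ x → bool-ext (no-new x) (f-infl C x)
  ... | inj₂ new    = inj₂ new

  grows-until-fixed : ∀ k C → k + count C ≤ count (iter k f C) ⊎ Fixed (iter k f C)
  grows-until-fixed zero    C = inj₁ ≤-refl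
  grows-until-fixed (suc k) C with grows-until-fixed k C
  ... | inj₂ fixed = inj₂ (f-cong fixed)
  ... | inj₁ grown with fixed-or-grows (iter k f C)
  ...   | inj₁ fixed             = inj₂ (f-cong fixed)
  ...   | inj₂ (w , new , old) =
    inj₁ (≤-trans (s≤s grown) (count-strict _ _ (f-infl (iter k f C)) w old new))

  fixed-after-n : ∀ C v → C v ≡ true → Fixed (iter n f C)
  fixed-after-n C v Cv with grows-until-fixed n C
  ... | inj₂ fixed   = fixed
  ... | inj₁ too-big = ⊥-elim (m+1+n≰m n (≤-trans (≤-reflexive (cong (n +_) (sym size)))
                                          (≤-trans too-big (count-≤ (iter n f C)))))
    where size = count-remove C v Cv

data Linked {n} (G : Graph n) (S : Subset n) : Fin n → Fin n → Set where
  linked-edge  : ∀ {x y} → inS S x ≡ false → inS S y ≡ false → Edge G x y → Linked G S x y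
  linked-refl  : ∀ {x} → Linked G S x x
  linked-sym   : ∀ {x y} → Linked G S x y → Linked G S y x
  linked-trans : ∀ {x y z} → Linked G S x y → Linked G S y z → Linked G S x z

stage : ∀ {n} → Graph n → Subset n → Fin n → ℕ → Fin n → Bool
stage G S v k = iter k (expand G S) (λ w → does (w ≟ v))

module _ {n} (G : Graph n) (S : Subset n) where

  expand-cong : ∀ {C D} → (∀ x → C x ≡ D x) → ∀ w → expand G S C w ≡ expand G S D w
  expand-cong C≗D w = cong₂ _∨_ (C≗D w)
    (cong (not (inS S w) ∧_) (cong or
      (map-cong (λ u → cong (_∧ adj G u w) (C≗D u)) (allFin n))))

  expand-inflationary : ∀ C w → C w ≡ true → expand G S C w ≡ true
  expand-inflationary C w Cw rewrite Cw = refl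

  open Stabilise (expand G S) expand-cong expand-inflationary using (fixed-after-n)

  stage-self : ∀ v k → stage G S v k v ≡ true
  stage-self v zero    = dec-true (v ≟ v) refl
  stage-self v (suc k) = expand-inflationary (stage G S v k) v (stage-self v k)

  comp-fixed : ∀ v w → expand G S (comp G S v) w ≡ comp G S v w
  comp-fixed v = fixed-after-n (λ w → does (w ≟ v)) v (stage-self v zero)

  comp-closed : ∀ v {u w} → comp G S v u ≡ true → inS S w ≡ false → Edge G u w →
    comp G S v w ≡ true
  comp-closed v {u} {w} vu w∉S uw = trans (sym (comp-fixed v w)) expanded
    where
    expanded : expand G S (comp G S v) w ≡ true
    expanded rewrite w∉S
      | any-allFin⁻ (λ u′ → comp G S v u′ ∧ adj G u′ w) u (cong₂ _∧_ vu uw) = ∨-zeroʳ _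

  stage-sound : ∀ v → inS S v ≡ false → ∀ k w → stage G S v k w ≡ true →
    Linked G S v w × inS S w ≡ false
  stage-sound v v∉S zero w found with w ≟ v
  ... | yes refl = linked-refl , v∉S
  stage-sound v v∉S (suc k) w found with stage G S v k w in earlier
  ... | true  = stage-sound v v∉S k w earlier
  ... | false with ∧-true found
  ...   | w∉S , edge-in with any-allFin⁺ (λ u → stage G S v k u ∧ adj G u w) edge-in
  ...     | u , u-edge with ∧-true u-edge
  ...       | vu , uw with stage-sound v v∉S k u vu
  ...         | v~u , u∉S = linked-trans v~u (linked-edge u∉S (not-true w∉S) uw) , not-true w∉S

  comp-linked : ∀ v {x y} → Linked G S x y → comp G S v x ≡ comp G S v y
  comp-linked v (linked-edge x∉S y∉S xy) =
    bool-ext (λ vx → comp-closed v vx y∉S xy)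
             (λ vy → comp-closed v vy x∉S (trans (Graph.sym G _ _) xy))
  comp-linked v linked-refl          = refl
  comp-linked v (linked-sym l)       = sym (comp-linked v l)
  comp-linked v (linked-trans l l′)  = trans (comp-linked v l) (comp-linked v l′)

  comp-complete : ∀ {v w} → Linked G S v w → comp G S v w ≡ true
  comp-complete {v} l = trans (sym (comp-linked v l)) (stage-self v n)

oddRep : ∀ {n} → Graph n → Subset n → Fin n → Bool
oddRep G S v = isRep G S v ∧ isOdd (compSize G S v)

oddComps-count : ∀ {n} (G : Graph n) (S : Subset n) → oddComps G S ≡ count (oddRep G S)
oddComps-count G S = count-allFin (oddRep G S)

AgreeOutside : ∀ {n} → Graph n → Graph n → Subset n → Set
AgreeOutside G G′ S = ∀ u w → inS S u ≡ false → inS S w ≡ false → adj G u w ≡ adj G′ u w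

module _ {n} (G G′ : Graph n) (S : Subset n) (agree : AgreeOutside G G′ S) where

  stage-agree : ∀ v → inS S v ≡ false → ∀ k w → stage G S v k w ≡ stage G′ S v k w
  stage-agree v v∉S zero    w = refl
  stage-agree v v∉S (suc k) w = trans (expand-cong G S (stage-agree v v∉S k) w) same-step
    where
    C = stage G′ S v k
    same-edges : inS S w ≡ false → ∀ u → (C u ∧ adj G u w) ≡ (C u ∧ adj G′ u w)
    same-edges w∉S u with C u in Cu
    ... | false = refl
    ... | true  = agree u w (proj₂ (stage-sound G′ S v v∉S k u Cu)) w∉S
    same-step : expand G S C w ≡ expand G′ S C w
    same-step with inS S w in w∈?S
    ... | true  = refl
    ... | false = cong (C w ∨_) (cong or (map-cong (same-edges w∈?S) (allFin n)))

  oddComps-agree : oddComps G S ≡ oddComps G′ S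
  oddComps-agree = begin
    oddComps G S          ≡⟨ oddComps-count G S ⟩
    count (oddRep G S)    ≡⟨ count-cong same-rep ⟩
    count (oddRep G′ S)   ≡⟨ oddComps-count G′ S ⟨
    oddComps G′ S         ∎
    where
    open ≡-Reasoning
    same-rep : ∀ v → oddRep G S v ≡ oddRep G′ S v
    same-rep v with inS S v in v∈?S
    ... | true  = refl
    ... | false = cong₂ (λ rep size → rep ∧ isOdd size)
      (cong and (map-cong (λ w → cong (λ c → if c then toℕ v ≤ᵇ toℕ w else true)
                                                   (stage-agree v v∈?S n w)) (allFin n)))
      (cong length (filterᵇ-cong (stage-agree v v∈?S n) (allFin n)))

matchedOut : ∀ {n} → (Fin n → Fin n) → Subset n → Fin n → Bool
matchedOut m S s = inS S s ∧ not (inS S (m s))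

-- Tutte's counting argument: for a perfect matching m, every odd component
-- of G − S contains a vertex matched into S, and distinct components use
-- distinct vertices of S.
module _ {n} (G : Graph n) (S : Subset n) (m : Fin n → Fin n) (pm : IsPM G m) where

  m-inv : ∀ x → m (m x) ≡ x
  m-inv x = proj₁ (pm x)

  m-fpf : ∀ x → m x ≢ x
  m-fpf x mx≡x with () ← trans (sym (Graph.irrefl G x)) (subst (Edge G x) mx≡x (proj₂ (pm x)))

  m-edge : ∀ x → Edge G x (m x)
  m-edge x = proj₂ (pm x)

  module _ {r} (rep : oddRep G S r ≡ true) where

    private
      isRep-r : isRep G S r ≡ true
      isRep-r = proj₁ (∧-true {isRep G S r} rep)

    rep∉S : inS S r ≡ false
    rep∉S = not-true (proj₁ (∧-true isRep-r))

    rep-least : ∀ {x} → comp G S r x ≡ true → toℕ r ≤ toℕ x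
    rep-least {x} rx = ≤ᵇ⇒≤ (toℕ r) (toℕ x) (Equivalence.from T-≡ (guarded rx
      (all-allFin⁺ (λ w → if comp G S r w then toℕ r ≤ᵇ toℕ w else true) (proj₂ (∧-true isRep-r)) x)))
      where
      guarded : ∀ {c b} → c ≡ true → (if c then b else true) ≡ true → b ≡ true
      guarded refl h = h

    comp-odd : isOdd (count (comp G S r)) ≡ true
    comp-odd = trans (cong isOdd (sym (count-allFin (comp G S r)))) (proj₂ (∧-true {isRep G S r} rep))

    -- The component has odd size, so it is not closed under m.
    escaping : ∃ λ w → comp G S r w ≡ true × comp G S r (m w) ≡ false
    escaping with subset-or-witness (comp G S r) (comp G S r ∘ m)
    ... | inj₂ escape = escape
    ... | inj₁ closed with () ← trans (sym comp-odd) (closed-even m m-inv m-fpf (comp G S r) closed)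

    escaper : Fin n
    escaper = proj₁ escaping

    escaper∈comp : comp G S r escaper ≡ true
    escaper∈comp = proj₁ (proj₂ escaping)

    escaper∉S : inS S escaper ≡ false
    escaper∉S = proj₂ (stage-sound G S r rep∉S n escaper escaper∈comp)

    partner : Fin n
    partner = m escaper

    partner∈S : inS S partner ≡ true
    partner∈S with inS S partner in p∈?S
    ... | true  = refl
    ... | false with () ← trans (sym (comp-closed G S r escaper∈comp p∈?S (m-edge escaper)))
                             (proj₂ (proj₂ escaping))

    partner-matchedOut : matchedOut m S partner ≡ true
    partner-matchedOut rewrite partner∈S | m-inv escaper | escaper∉S = refl

  -- Equal partners come from the same escaping vertex, hence the same
  -- component, hence the same (least) representative.
  partner-injective : ∀ r s (p : oddRep G S r ≡ true) (q : oddRep G S s ≡ true) →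
    partner p ≡ partner q → r ≡ s
  partner-injective r s p q same = toℕ-injective
    (≤-antisym (rep-least p (comp-complete G S r~s)) (rep-least q (comp-complete G S (linked-sym r~s))))
    where
    same-escaper : escaper p ≡ escaper q
    same-escaper = trans (sym (m-inv (escaper p))) (trans (cong m same) (m-inv (escaper q)))
    r~s : Linked G S r s
    r~s = linked-trans (proj₁ (stage-sound G S r (rep∉S p) n _ (escaper∈comp p)))
            (subst (λ w → Linked G S w s) (sym same-escaper)
              (linked-sym (proj₁ (stage-sound G S s (rep∉S q) n _ (escaper∈comp q)))))

  oddComps≤matchedOut : oddComps G S ≤ count (matchedOut m S)
  oddComps≤matchedOut rewrite oddComps-count G S =
    count-injection (oddRep G S) (matchedOut m S) (λ _ p → partner p)
      (λ _ p → partner-matchedOut p) partner-injective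

barrier-matched-out : ∀ {n} (G : Graph n) (S : Subset n) {m} → Barrier G S → IsPM G m →
  ∀ u → inS S u ≡ true → inS S (m u) ≡ false
barrier-matched-out {n} G S {m} barrier pm u u∈S with inS S (m u) in mu∈S
... | false = refl
... | true  = ⊥-elim (<-irrefl refl too-few)
  where
  open ≤-Reasoning
  fewer-out : count (matchedOut m S) < count (inS S)
  fewer-out = count-strict (matchedOut m S) (inS S) (λ x out → proj₁ (∧-true out)) u
             (cong₂ (λ a b → a ∧ not b) u∈S mu∈S) u∈S
  too-few : count (matchedOut m S) < count (matchedOut m S)
  too-few = begin-strict
    count (matchedOut m S) <⟨ fewer-out ⟩
    count (inS S)          ≡⟨ card-count S ⟨
    ∣ S ∣                  ≡⟨ barrier ⟨
    oddComps G S           ≤⟨ oddComps≤matchedOut G S m pm ⟩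
    count (matchedOut m S) ∎

isPMᵇ-sound : ∀ {n} (K : Graph n) m → isPMᵇ K m ≡ true → IsPM K m
isPMᵇ-sound K m h v
  with m (m v) ≟ v | ∧-true {does (m (m v) ≟ v)} (all-allFin⁺ (λ v → does (m (m v) ≟ v) ∧ adj K v (m v)) h v)
... | yes involutive | _  , edge = involutive , edge
... | no  _          | () , _

isPMᵇ-complete : ∀ {n} (K : Graph n) m → IsPM K m → isPMᵇ K m ≡ true
isPMᵇ-complete K m pm = all-allFin⁻ _ λ v → cong₂ _∧_ (dec-true (m (m v) ≟ v) (proj₁ (pm v))) (proj₂ (pm v))

Φ-cong : ∀ {n} (G G′ : Graph n) → (∀ m → IsPM G m → IsPM G′ m) → (∀ m → IsPM G′ m → IsPM G m) →
  Φ G ≡ Φ G′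
Φ-cong {n} G G′ to from = cong length (filterᵇ-cong same (allVecs n n))
  where
  same : ∀ xs → isPMᵇ G (lookup xs) ≡ isPMᵇ G′ (lookup xs)
  same xs = bool-ext
    (λ h → isPMᵇ-complete G′ _ (to _ (isPMᵇ-sound G _ h)))
    (λ h → isPMᵇ-complete G _ (from _ (isPMᵇ-sound G′ _ h)))

innerPair : ∀ {n} → Subset n → Fin n → Fin n → Bool
innerPair S x y = inS S x ∧ (inS S y ∧ not (does (x ≟ y)))

saturate : ∀ {n} → Graph n → Subset n → Graph n
saturate G S = record
  { adj    = λ x y → adj G x y ∨ innerPair S x y
  ; sym    = λ x y → cong₂ _∨_ (Graph.sym G x y) (inner-sym x y)
  ; irrefl = λ x → cong₂ _∨_ (Graph.irrefl G x) (inner-irrefl x)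
  }
  where
  inner-sym : ∀ x y → innerPair S x y ≡ innerPair S y x
  inner-sym x y rewrite ≟-sym x y = ∧-swap (inS S x) (inS S y) _
  inner-irrefl : ∀ x → innerPair S x x ≡ false
  inner-irrefl x rewrite dec-true (x ≟ x) refl | ∧-zeroʳ (inS S x) = ∧-zeroʳ (inS S x)

module _ {n} (G : Graph n) (S : Subset n) where

  ⊑-saturate : G ⊑ saturate G S
  ⊑-saturate x y xy = cong (_∨ innerPair S x y) xy

  saturate-clique : Clique (saturate G S) S
  saturate-clique u v u∈S v∈S u≢v
    rewrite []=⇒lookup u∈S | []=⇒lookup v∈S | dec-false (u ≟ v) u≢v = ∨-zeroʳ (adj G u v)

  saturate-agree : AgreeOutside G (saturate G S) S
  saturate-agree u w u∉S _ rewrite u∉S = sym (∨-identityʳ (adj G u w))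

  module _ (barrier : Barrier G S) where

    -- G − S is unchanged, so S stays a barrier.
    saturate-barrier : Barrier (saturate G S) S
    saturate-barrier = trans (sym (oddComps-agree G (saturate G S) S saturate-agree)) barrier

    saturate-matching : ∀ m → IsPM (saturate G S) m → IsPM G m
    saturate-matching m pm v = proj₁ (pm v) , old-edge
      where
      not-inner : innerPair S v (m v) ≡ false
      not-inner with inS S v in v∈?S
      ... | false = refl
      ... | true  = cong (_∧ not (does (v ≟ m v))) (barrier-matched-out (saturate G S) S saturate-barrier pm v v∈?S)
      old-edge : Edge G v (m v)
      old-edge = trans (sym (∨-identityʳ _))
                   (trans (cong (adj G v (m v) ∨_) (sym not-inner)) (proj₂ (pm v)))

    Φ-saturate : Φ (saturate G S) ≡ Φ G
    Φ-saturate = Φ-cong (saturate G S) G saturate-matching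
      (λ m pm v → proj₁ (pm v) , ⊑-saturate v (m v) (proj₂ (pm v)))

proposition5p3 : ∀ {n : ℕ} (H G : Graph n) → OneExtendable H → MaximalInE H G →
    ∀ (S : Subset n) → MaximalBarrier G S →
      Clique G S × (∀ u v → u ∈ S → v ∈ S → Edge G u v → Free G u v)
proposition5p3 H G _ ((H⊑G , ΦG≡ΦH) , maximal) S (barrier , _) = clique , free
  where
  saturate∈E : InE H (saturate G S)
  saturate∈E = (λ x y xy → ⊑-saturate G S x y (H⊑G x y xy)) , trans (Φ-saturate G S barrier) ΦG≡ΦH
  saturate⊑G : saturate G S ⊑ G
  saturate⊑G = maximal (saturate G S) saturate∈E (⊑-saturate G S)
  clique : Clique G S
  clique u v u∈S v∈S u≢v = saturate⊑G u v (saturate-clique G S u v u∈S v∈S u≢v)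
  -- A perfect matching through uv would match u into the barrier S.
  free : ∀ u v → u ∈ S → v ∈ S → Edge G u v → Free G u v
  free u v u∈S v∈S _ (m , pm , mu≡v) with () ←
    trans (sym (barrier-matched-out G S barrier pm u ([]=⇒lookup u∈S)))
          (subst (λ w → inS S w ≡ true) (sym mu≡v) ([]=⇒lookup v∈S))
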